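{- Let $k\ge1$ and let $a=(a_1,\dots,a_k)$, $b=(b_1,\dots,b_k)$ be $k$-tuples of nonnegative integers, with $|a|=\sum_i a_i$ and $|b|=\sum_i b_i$. Then $\tilde M_k(a,b)=0$ unless $a_1=\dots=a_{k-|a|}=0$ and $b_1=\dots=b_{k-|b|}=0$.
   Context: $\tilde M_k(a,b)=(-1)^{\sum_i b_i}\det M$, where $M$ is the $2k\times2k$ matrix with entries, for $1\le i\le k$, $1\le j\le 2k$: $M_{i,j}=1/\Gamma(2k-i-j+2-a_i)$ and $M_{k+i,j}=(-1)^{i+j-1}/\Gamma(2k-i-j+2-b_i)$, with the convention $1/\Gamma(m)=0$ for $m\in\{0,-1,-2,\dots\}$. (When $|a|\ge k$ the condition on $a$ is vacuous, and likewise for $b$.) -}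

module Defs where

open import Data.Nat as ℕ using (ℕ; zero; suc; _!; _∸_)
open import Data.Nat.Properties using (_!≢0)
open import Data.Integer as ℤ using (ℤ; +_; -[1+_])
open import Data.Rational as ℚ using (ℚ; 0ℚ; 1ℚ; -_; _*_; _+_)
open import Data.Fin using (Fin; zero; suc; toℕ; splitAt; punchIn)
open import Data.Sum using (inj₁; inj₂)

sumFin : (n : ℕ) → (Fin n → ℚ) → ℚ
sumFin zero    f = 0ℚ
sumFin (suc n) f = f zero + sumFin n (λ i → f (suc i))

signℚ : ℕ → ℚ
signℚ zero    = 1ℚ
signℚ (suc n) = - signℚ n

det : (n : ℕ) → (Fin n → Fin n → ℚ) → ℚ
det zero    A = 1ℚ
det (suc n) A =
  sumFin (suc n) (λ j → signℚ (toℕ j) * (A zero j * det n (λ r c → A (suc r) (punchIn j c))))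

-- 1/Γ(m) for an integer m, with 1/Γ(m) = 0 for m ∈ {0,-1,-2,...},
-- and 1/Γ(m) = 1/(m-1)! for m ≥ 1.
recipGamma : ℤ → ℚ
recipGamma (+ zero)    = 0ℚ
recipGamma -[1+ n ]    = 0ℚ
recipGamma (+ (suc n)) = ((+ 1) ℚ./ (n !)) {{n !≢0}}

∣_∣ : {k : ℕ} → (Fin k → ℕ) → ℕ
∣_∣ {zero}  a = 0
∣_∣ {suc k} a = a zero ℕ.+ ∣ (λ i → a (suc i)) ∣

-- The 2k×2k matrix M (0-indexed: row i, column j correspond to the
-- paper's i+1, j+1).  For rows 1..k:  1/Γ(2k-i-j+2-a_i);
-- for rows k+1..2k:  (-1)^{i+j-1}/Γ(2k-i-j+2-b_i)  (paper's 1-indexed i, j).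
Mmat : (k : ℕ) → (a b : Fin k → ℕ) → Fin (k ℕ.+ k) → Fin (k ℕ.+ k) → ℚ
Mmat k a b r j with splitAt k r
... | inj₁ i = recipGamma (+ (2 ℕ.* k) ℤ.- + (toℕ i) ℤ.- + (toℕ j) ℤ.- + (a i))
... | inj₂ i = signℚ (suc (toℕ i ℕ.+ toℕ j))
               * recipGamma (+ (2 ℕ.* k) ℤ.- + (toℕ i) ℤ.- + (toℕ j) ℤ.- + (b i))

Mtilde : (k : ℕ) → (a b : Fin k → ℕ) → ℚ
Mtilde k a b = signℚ ∣ b ∣ * det (k ℕ.+ k) (Mmat k a b)

-- a_1 = ... = a_{k-|a|} = 0  (vacuous when |a| ≥ k, via truncated subtraction).
LeadingZeros : {k : ℕ} → (Fin k → ℕ) → Set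
LeadingZeros {k} a = (i : Fin k) → toℕ i ℕ.< k ∸ ∣ a ∣ → a i ≡ 0
  where open import Relation.Binary.PropositionalEquality using (_≡_)

{-# OPTIONS --safe #-}
module Submission where

-- Row i of the upper block of M depends on i only through i + a_i, and row i of the lower
-- block, up to the factor (-1)^i, only through i + b_i.  Hence det M = 0 unless both maps
-- i ↦ i + a_i and i ↦ i + b_i are injective, since otherwise M has two proportional rows.
-- An injective i ↦ i + a_i forces a_i = 0 for i < k - |a|: by induction on k, if a_0 = u + 1
-- then index u + 1 is still in that range for the tail, so a_{u+1} = 0 and u + 1 collides
-- with 0.  The vanishing of det on proportional rows comes from the first-row Laplace
-- expansion, through the fact that exchanging two rows negates the determinant.

open import Defs
open import Data.Nat using (ℕ; _≥_)
open import Data.Fin using (Fin)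
open import Data.Product using (_×_)
open import Data.Rational using (0ℚ)
open import Relation.Nullary using (¬_)
open import Relation.Binary.PropositionalEquality using (_≡_)

open import Algebra.Bundles using (CommutativeRing)
open import Data.Fin using (zero; suc; toℕ; punchIn; punchOut; _≟_; _↑ˡ_; _↑ʳ_; fromℕ<)
open import Data.Fin.Properties
  using (suc-injective; punchInᵢ≢i; punchOut-cong; punchOut-punchIn; splitAt-↑ˡ; splitAt-↑ʳ;
         ↑ˡ-injective; ↑ʳ-injective; toℕ-fromℕ<)
import Data.Integer as ℤ
open import Data.Integer.Properties using (pos-+)
import Data.Integer.Solver as ℤ-Solver
open import Data.Nat as ℕ using (zero; suc)
open import Data.Nat.Properties as ℕ using ()
open import Data.Product using (_,_)
open import Data.Rational using (ℚ; 1ℚ; ½; _+_; _*_; -_)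
open import Data.Rational.Properties
  using (+-*-ring; +-*-commutativeRing; +-identityˡ; +-inverseʳ; *-assoc; *-identityˡ; *-zeroʳ;
         neg-distribˡ-*; neg-distribʳ-*)
  renaming (_≟_ to _≟ℚ_)
open import Data.Rational.Solver using (module +-*-Solver)
open import Algebra.Properties.Ring +-*-ring using (-‿involutive; -1*x≈-x)
open import Algebra.Properties.CommutativeSemigroup
  (CommutativeRing.*-commutativeSemigroup +-*-commutativeRing) using (x∙yz≈y∙xz)
open import Algebra.Properties.Semiring.Sum (CommutativeRing.semiring +-*-commutativeRing)
  using (sum; sum-cong-≗; sum-remove; ∑-comm; *-distribˡ-sum)
open import Data.Vec.Functional using (updateAt)
open import Data.Vec.Functional.Properties using (updateAt-updates; updateAt-minimal)
open import Function using (_∘_; const; Injective)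
open import Relation.Binary.PropositionalEquality
  using (refl; sym; trans; cong; cong₂; cong-app; subst; _≢_; _≗_; module ≡-Reasoning)
open import Relation.Nullary using (yes; no; contradiction)
open import Relation.Nullary.Decidable using (decidable-stable)

open +-*-Solver using (solve; _:+_; _:*_; :-_; _:=_; con)

Matrix : ℕ → Set
Matrix n = Fin n → Fin n → ℚ

minor : ∀ {n} → Matrix (suc n) → Fin (suc n) → Matrix n
minor A j r c = A (suc r) (punchIn j c)

sumFin≡sum : ∀ n (f : Fin n → ℚ) → sumFin n f ≡ sum f
sumFin≡sum zero    f = refl
sumFin≡sum (suc n) f = cong (f zero +_) (sumFin≡sum n (f ∘ suc))

det-suc : ∀ n (A : Matrix (suc n)) →
  det (suc n) A ≡ sum (λ j → signℚ (toℕ j) * (A zero j * det n (minor A j)))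
det-suc n A = sumFin≡sum (suc n) (λ j → signℚ (toℕ j) * (A zero j * det n (minor A j)))

det-cong : ∀ n {A B : Matrix n} → (∀ r → A r ≗ B r) → det n A ≡ det n B
det-cong zero    A≗B = refl
det-cong (suc n) {A} {B} A≗B = begin
  det (suc n) A
    ≡⟨ det-suc n A ⟩
  sum (λ j → signℚ (toℕ j) * (A zero j * det n (minor A j)))
    ≡⟨ sum-cong-≗ (λ j → cong₂ (λ x d → signℚ (toℕ j) * (x * d))
         (A≗B zero j) (det-cong n (λ r c → A≗B (suc r) (punchIn j c)))) ⟩
  sum (λ j → signℚ (toℕ j) * (B zero j * det n (minor B j)))
    ≡⟨ sym (det-suc n B) ⟩
  det (suc n) B ∎
  where open ≡-Reasoning

sum-neg : ∀ {n} (f : Fin n → ℚ) → sum (λ i → - f i) ≡ - sum f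
sum-neg f = begin
  sum (λ i → - f i)        ≡⟨ sum-cong-≗ (λ i → sym (-1*x≈-x (f i))) ⟩
  sum (λ i → - 1ℚ * f i)   ≡⟨ sym (*-distribˡ-sum (- 1ℚ) f) ⟩
  - 1ℚ * sum f             ≡⟨ -1*x≈-x (sum f) ⟩
  - sum f                  ∎
  where open ≡-Reasoning

signℚ-+ : ∀ m n → signℚ (m ℕ.+ n) ≡ signℚ m * signℚ n
signℚ-+ zero    n = sym (*-identityˡ (signℚ n))
signℚ-+ (suc m) n = trans (cong -_ (signℚ-+ m n)) (neg-distribˡ-* (signℚ m) (signℚ n))

signℚ-square : ∀ n → signℚ n * signℚ n ≡ 1ℚ
signℚ-square zero    = refl
signℚ-square (suc n) =
  trans (solve 1 (λ s → :- s :* :- s := s :* s) refl (signℚ n)) (signℚ-square n)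

signℚ-square-cancel : ∀ m n x → signℚ n * signℚ m * (signℚ m * x) ≡ signℚ n * x
signℚ-square-cancel m n x = begin
  signℚ n * signℚ m * (signℚ m * x)
    ≡⟨ solve 3 (λ t s x → t :* s :* (s :* x) := t :* (s :* s :* x)) refl (signℚ n) (signℚ m) x ⟩
  signℚ n * (signℚ m * signℚ m * x)
    ≡⟨ cong (λ u → signℚ n * (u * x)) (signℚ-square m) ⟩
  signℚ n * (1ℚ * x)
    ≡⟨ cong (signℚ n *_) (*-identityˡ x) ⟩
  signℚ n * x ∎
  where open ≡-Reasoning

signℚ-2+ : ∀ m n → signℚ (suc (m ℕ.+ suc n)) ≡ signℚ (m ℕ.+ n)
signℚ-2+ m n = trans (cong (signℚ ∘ suc) (ℕ.+-suc m n)) (-‿involutive (signℚ (m ℕ.+ n)))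

-- For x < y the two exponents are x + (y - 1) and y + x.
signℚ-punchOut-swap : ∀ {m} {x y : Fin (suc m)} (x≢y : x ≢ y) (y≢x : y ≢ x) →
  signℚ (toℕ x ℕ.+ toℕ (punchOut x≢y)) ≡ - signℚ (toℕ y ℕ.+ toℕ (punchOut y≢x))
signℚ-punchOut-swap {_}     {zero}  {zero}  x≢y _ = contradiction refl x≢y
signℚ-punchOut-swap {suc m} {zero}  {suc y} _   _ =
  sym (trans (-‿involutive _) (cong signℚ (ℕ.+-identityʳ (toℕ y))))
signℚ-punchOut-swap {suc m} {suc x} {zero}  _   _ = cong (-_ ∘ signℚ) (ℕ.+-identityʳ (toℕ x))
signℚ-punchOut-swap {suc m} {suc x} {suc y} x≢y y≢x =
  trans (signℚ-2+ (toℕ x) _)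
    (trans (signℚ-punchOut-swap (x≢y ∘ cong suc) (y≢x ∘ cong suc))
      (cong -_ (sym (signℚ-2+ (toℕ y) _))))

det-scale-termwise : ∀ n {A B : Matrix (suc n)} c →
  (∀ j → B zero j * det n (minor B j) ≡ c * (A zero j * det n (minor A j))) →
  det (suc n) B ≡ c * det (suc n) A
det-scale-termwise n {A} {B} c terms = begin
  det (suc n) B
    ≡⟨ det-suc n B ⟩
  sum (λ j → signℚ (toℕ j) * (B zero j * det n (minor B j)))
    ≡⟨ sum-cong-≗ (λ j → trans (cong (signℚ (toℕ j) *_) (terms j))
                                  (x∙yz≈y∙xz (signℚ (toℕ j)) c (termA j))) ⟩
  sum (λ j → c * (signℚ (toℕ j) * termA j))
    ≡⟨ sym (*-distribˡ-sum c (λ j → signℚ (toℕ j) * termA j)) ⟩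
  c * sum (λ j → signℚ (toℕ j) * termA j)
    ≡⟨ cong (c *_) (sym (det-suc n A)) ⟩
  c * det (suc n) A ∎
  where
  open ≡-Reasoning
  termA : Fin (suc n) → ℚ
  termA j = A zero j * det n (minor A j)

det-scaleRow : ∀ n {A B : Matrix n} {p} c →
  (∀ j → B p j ≡ c * A p j) → (∀ r → r ≢ p → B r ≗ A r) → det n B ≡ c * det n A
det-scaleRow (suc n) {A} {B} {zero} c scaled unchanged = det-scale-termwise n {A} {B} c λ j →
  trans (cong₂ _*_ (scaled j) (det-cong n (λ r → unchanged (suc r) (λ ()) ∘ punchIn j)))
        (*-assoc c (A zero j) (det n (minor A j)))
det-scaleRow (suc n) {A} {B} {suc p} c scaled unchanged = det-scale-termwise n {A} {B} c λ j →
  trans (cong₂ _*_ (unchanged zero (λ ()) j)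
          (det-scaleRow n c (scaled ∘ punchIn j)
            (λ r r≢p → unchanged (suc r) (r≢p ∘ suc-injective) ∘ punchIn j)))
        (x∙yz≈y∙xz (A zero j) c (det n (minor A j)))

record RowsSwapped {n} (p q : Fin n) (A B : Matrix n) : Set where
  field
    distinct  : p ≢ q
    swapped-p : B p ≗ A q
    swapped-q : B q ≗ A p
    unchanged : ∀ r → r ≢ p → r ≢ q → B r ≗ A r

RowsSwapped-sym : ∀ {n} {p q : Fin n} {A B} → RowsSwapped p q A B → RowsSwapped q p A B
RowsSwapped-sym s = record
  { distinct  = distinct ∘ sym
  ; swapped-p = swapped-q
  ; swapped-q = swapped-p
  ; unchanged = λ r r≢q r≢p → unchanged r r≢p r≢q
  }
  where open RowsSwapped s

RowsSwapped-minor : ∀ {n} {p q : Fin n} {A B} → RowsSwapped (suc p) (suc q) A B →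
  ∀ j → RowsSwapped p q (minor A j) (minor B j)
RowsSwapped-minor s j = record
  { distinct  = distinct ∘ cong suc
  ; swapped-p = swapped-p ∘ punchIn j
  ; swapped-q = swapped-q ∘ punchIn j
  ; unchanged = λ r r≢p r≢q →
      unchanged (suc r) (r≢p ∘ suc-injective) (r≢q ∘ suc-injective) ∘ punchIn j
  }
  where open RowsSwapped s

swapRows : ∀ {n} → Matrix n → Fin n → Fin n → Matrix n
swapRows A p q = updateAt (updateAt A p (const (A q))) q (const (A p))

swapRows-swaps : ∀ {n} (A : Matrix n) {p q} → p ≢ q → RowsSwapped p q A (swapRows A p q)
swapRows-swaps A {p} {q} p≢q = record
  { distinct  = p≢q
  ; swapped-p = cong-app (trans (updateAt-minimal p q _ p≢q) (updateAt-updates p A))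
  ; swapped-q = cong-app (updateAt-updates q _)
  ; unchanged = λ r r≢p r≢q →
      cong-app (trans (updateAt-minimal r q _ r≢q) (updateAt-minimal r p A r≢p))
  }

SwapNegatesDet : ℕ → Set
SwapNegatesDet n = ∀ {p q} {A B : Matrix n} → RowsSwapped p q A B → det n B ≡ - det n A

det-swap-suc : ∀ {n} → SwapNegatesDet n →
  ∀ {p q} {A B : Matrix (suc n)} → RowsSwapped (suc p) (suc q) A B → det (suc n) B ≡ - det (suc n) A
det-swap-suc {n} swap {A = A} {B} s = begin
  det (suc n) B
    ≡⟨ det-scale-termwise n {A} {B} (- 1ℚ) (λ j →
         trans (cong₂ _*_ (RowsSwapped.unchanged s zero (λ ()) (λ ()) j)
                          (swap (RowsSwapped-minor s j)))
               (neg-to-front (A zero j) (det n (minor A j)))) ⟩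
  - 1ℚ * det (suc n) A
    ≡⟨ -1*x≈-x (det (suc n) A) ⟩
  - det (suc n) A ∎
  where
  open ≡-Reasoning
  neg-to-front : ∀ x y → x * - y ≡ - 1ℚ * (x * y)
  neg-to-front x y = trans (sym (neg-distribʳ-* x y)) (sym (-1*x≈-x (x * y)))

punchIn-punchOut-comm : ∀ {m} {x y : Fin (suc (suc m))} (x≢y : x ≢ y) (y≢x : y ≢ x) (c : Fin m) →
  punchIn x (punchIn (punchOut x≢y) c) ≡ punchIn y (punchIn (punchOut y≢x) c)
punchIn-punchOut-comm {x = zero}  {zero}  x≢y _   _       = contradiction refl x≢y
punchIn-punchOut-comm {x = zero}  {suc y} _   _   _       = refl
punchIn-punchOut-comm {x = suc x} {zero}  _   _   _       = refl
punchIn-punchOut-comm {x = suc x} {suc y} _   _   zero    = refl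
punchIn-punchOut-comm {x = suc x} {suc y} x≢y y≢x (suc c) =
  cong suc (punchIn-punchOut-comm (x≢y ∘ cong suc) (y≢x ∘ cong suc) c)

-- Expanding det A along row 0 and then each minor along its first row writes det A as a sum
-- over pairs x ≢ y of ± A₀ₓ A₁ᵧ det(A without rows 0, 1 and columns x, y).  pairTerm is
-- that summand, set to 0 on the diagonal so that the double sum runs over all of Fin × Fin
-- and can be reindexed; exchanging rows 0 and 1 exchanges x and y and flips the sign.
pairTerm : ∀ {m} → Matrix (suc (suc m)) → Fin (suc (suc m)) → Fin (suc (suc m)) → ℚ
pairTerm {m} A x y with x ≟ y
... | yes _   = 0ℚ
... | no x≢y = signℚ (toℕ x ℕ.+ toℕ (punchOut x≢y))
                 * (A zero x * (A (suc zero) y * det m (minor (minor A x) (punchOut x≢y))))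

pairTerm-diag : ∀ {m} (A : Matrix (suc (suc m))) x → pairTerm A x x ≡ 0ℚ
pairTerm-diag A x with x ≟ x
... | yes _   = refl
... | no x≢x = contradiction refl x≢x

pairTerm-punchIn : ∀ {m} (A : Matrix (suc (suc m))) x c →
  pairTerm A x (punchIn x c) ≡ signℚ (toℕ x ℕ.+ toℕ c)
    * (A zero x * (A (suc zero) (punchIn x c) * det m (minor (minor A x) c)))
pairTerm-punchIn {m} A x c with x ≟ punchIn x c
... | yes x≡x′ = contradiction (sym x≡x′) (punchInᵢ≢i x c)
... | no x≢x′ = cong (λ c′ → signℚ (toℕ x ℕ.+ toℕ c′)
                       * (A zero x * (A (suc zero) (punchIn x c) * det m (minor (minor A x) c′))))
                     (trans (punchOut-cong x refl) (punchOut-punchIn x))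

det-expand₂ : ∀ {m} (A : Matrix (suc (suc m))) →
  det (suc (suc m)) A ≡ sum (λ x → sum (λ y → pairTerm A x y))
det-expand₂ {m} A = trans (det-suc (suc m) A) (sum-cong-≗ expand-row)
  where
  open ≡-Reasoning
  expand-row : ∀ x → signℚ (toℕ x) * (A zero x * det (suc m) (minor A x)) ≡ sum (pairTerm A x)
  expand-row x = begin
    signℚ (toℕ x) * (A zero x * det (suc m) (minor A x))
      ≡⟨ sym (*-assoc (signℚ (toℕ x)) (A zero x) _) ⟩
    signℚ (toℕ x) * A zero x * det (suc m) (minor A x)
      ≡⟨ cong (signℚ (toℕ x) * A zero x *_) (det-suc m (minor A x)) ⟩
    signℚ (toℕ x) * A zero x * sum (λ c → signℚ (toℕ c) * term c)
      ≡⟨ *-distribˡ-sum (signℚ (toℕ x) * A zero x) (λ c → signℚ (toℕ c) * term c) ⟩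
    sum (λ c → signℚ (toℕ x) * A zero x * (signℚ (toℕ c) * term c))
      ≡⟨ sum-cong-≗ (λ c → trans (regroup (signℚ (toℕ x)) (A zero x) (signℚ (toℕ c)) (term c))
                          (trans (cong (_* (A zero x * term c)) (sym (signℚ-+ (toℕ x) (toℕ c))))
                                 (sym (pairTerm-punchIn A x c)))) ⟩
    sum (λ c → pairTerm A x (punchIn x c))
      ≡⟨ sym (+-identityˡ _) ⟩
    0ℚ + sum (λ c → pairTerm A x (punchIn x c))
      ≡⟨ cong (_+ sum (λ c → pairTerm A x (punchIn x c))) (sym (pairTerm-diag A x)) ⟩
    pairTerm A x x + sum (λ c → pairTerm A x (punchIn x c))
      ≡⟨ sym (sum-remove (pairTerm A x)) ⟩
    sum (pairTerm A x) ∎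
    where
    term : Fin (suc m) → ℚ
    term c = A (suc zero) (punchIn x c) * det m (minor (minor A x) c)
    regroup : ∀ s a t u → s * a * (t * u) ≡ s * t * (a * u)
    regroup = solve 4 (λ s a t u → s :* a :* (t :* u) := s :* t :* (a :* u)) refl

pairTerm-swap : ∀ {m} {A B : Matrix (suc (suc m))} → RowsSwapped zero (suc zero) A B →
  ∀ x y → pairTerm B x y ≡ - pairTerm A y x
pairTerm-swap s x y with x ≟ y | y ≟ x
... | yes _   | yes _   = refl
... | yes x≡y | no y≢x = contradiction (sym x≡y) y≢x
... | no x≢y | yes y≡x = contradiction (sym y≡x) x≢y
pairTerm-swap {m} {A} {B} s x y | no x≢y | no y≢x = begin
  signℚ (toℕ x ℕ.+ toℕ (punchOut x≢y))
    * (B zero x * (B (suc zero) y * det m (minor (minor B x) (punchOut x≢y))))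
    ≡⟨ cong₂ (λ u v → signℚ (toℕ x ℕ.+ toℕ (punchOut x≢y)) * (u * v)) (swapped-p x)
         (cong₂ _*_ (swapped-q y) (det-cong m (λ r c →
           trans (unchanged (suc (suc r)) (λ ()) (λ ()) _)
                 (cong (A (suc (suc r))) (punchIn-punchOut-comm x≢y y≢x c))))) ⟩
  signℚ (toℕ x ℕ.+ toℕ (punchOut x≢y)) * (A (suc zero) x * (A zero y * d))
    ≡⟨ cong (_* (A (suc zero) x * (A zero y * d))) (signℚ-punchOut-swap x≢y y≢x) ⟩
  - signℚ (toℕ y ℕ.+ toℕ (punchOut y≢x)) * (A (suc zero) x * (A zero y * d))
    ≡⟨ regroup (signℚ (toℕ y ℕ.+ toℕ (punchOut y≢x))) (A (suc zero) x) (A zero y) d ⟩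
  - (signℚ (toℕ y ℕ.+ toℕ (punchOut y≢x)) * (A zero y * (A (suc zero) x * d))) ∎
  where
  open ≡-Reasoning
  open RowsSwapped s
  d : ℚ
  d = det m (minor (minor A y) (punchOut y≢x))
  regroup : ∀ s a b u → - s * (a * (b * u)) ≡ - (s * (b * (a * u)))
  regroup = solve 4 (λ s a b u → :- s :* (a :* (b :* u)) := :- (s :* (b :* (a :* u)))) refl

det-swap₀₁ : ∀ {m} {A B : Matrix (suc (suc m))} → RowsSwapped zero (suc zero) A B →
  det (suc (suc m)) B ≡ - det (suc (suc m)) A
det-swap₀₁ {m} {A} {B} s = begin
  det (suc (suc m)) B
    ≡⟨ det-expand₂ B ⟩
  sum (λ x → sum (λ y → pairTerm B x y))
    ≡⟨ sum-cong-≗ (λ x → sum-cong-≗ (pairTerm-swap s x)) ⟩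
  sum (λ x → sum (λ y → - pairTerm A y x))
    ≡⟨ sum-cong-≗ (λ x → sum-neg (λ y → pairTerm A y x)) ⟩
  sum (λ x → - sum (λ y → pairTerm A y x))
    ≡⟨ sum-neg (λ x → sum (λ y → pairTerm A y x)) ⟩
  - sum (λ x → sum (λ y → pairTerm A y x))
    ≡⟨ cong -_ (∑-comm (λ x y → pairTerm A y x)) ⟩
  - sum (λ y → sum (λ x → pairTerm A y x))
    ≡⟨ cong -_ (sym (det-expand₂ A)) ⟩
  - det (suc (suc m)) A ∎
  where open ≡-Reasoning

-- The transposition (0 q′) is the conjugate (1 q′) (0 1) (1 q′).
det-swap-conj : ∀ {m} → SwapNegatesDet (suc m) →
  ∀ {q} {A B : Matrix (suc (suc m))} → RowsSwapped zero (suc (suc q)) A B →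
  det (suc (suc m)) B ≡ - det (suc (suc m)) A
det-swap-conj {m} swap {q} {A} {B} s = begin
  det N B       ≡⟨ sym (-‿involutive (det N B)) ⟩
  - - det N B   ≡⟨ cong -_ (sym (det-swap-suc swap sD)) ⟩
  - det N D     ≡⟨ cong -_ (det-swap₀₁ sCD) ⟩
  - - det N C   ≡⟨ -‿involutive (det N C) ⟩
  det N C       ≡⟨ det-swap-suc swap sC ⟩
  - det N A     ∎
  where
  open ≡-Reasoning
  N : ℕ
  N = suc (suc m)
  q′ : Fin N
  q′ = suc (suc q)
  C D : Matrix N
  C = swapRows A (suc zero) q′
  D = swapRows B (suc zero) q′
  sC : RowsSwapped (suc zero) q′ A C
  sC = swapRows-swaps A (λ ())
  sD : RowsSwapped (suc zero) q′ B D
  sD = swapRows-swaps B (λ ())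
  module S = RowsSwapped s
  module SC = RowsSwapped sC
  module SD = RowsSwapped sD
  rest : ∀ r → r ≢ zero → r ≢ suc zero → D r ≗ C r
  rest zero          r≢0 _   = contradiction refl r≢0
  rest (suc zero)    _   r≢1 = contradiction refl r≢1
  rest (suc (suc r)) _   _   with r ≟ q
  ... | yes refl = λ j → trans (SD.swapped-q j)
                          (trans (S.unchanged (suc zero) (λ ()) (λ ()) j) (sym (SC.swapped-q j)))
  ... | no r≢q  = λ j → trans (SD.unchanged _ (λ ()) r≢q′ j)
                          (trans (S.unchanged _ (λ ()) r≢q′ j) (sym (SC.unchanged _ (λ ()) r≢q′ j)))
    where r≢q′ = r≢q ∘ suc-injective ∘ suc-injective
  sCD : RowsSwapped zero (suc zero) C D
  sCD = record
    { distinct  = λ ()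
    ; swapped-p = λ j → trans (SD.unchanged zero (λ ()) (λ ()) j)
                          (trans (S.swapped-p j) (sym (SC.swapped-p j)))
    ; swapped-q = λ j → trans (SD.swapped-p j)
                          (trans (S.swapped-q j) (sym (SC.unchanged zero (λ ()) (λ ()) j)))
    ; unchanged = rest
    }

det-swap : ∀ n → SwapNegatesDet n
det-swap (suc n)       {zero}        {zero}        s = contradiction refl (RowsSwapped.distinct s)
det-swap (suc n)       {suc p}       {suc q}       s = det-swap-suc (det-swap n) s
det-swap (suc (suc m)) {zero}        {suc zero}    s = det-swap₀₁ s
det-swap (suc (suc m)) {suc zero}    {zero}        s = det-swap₀₁ (RowsSwapped-sym s)
det-swap (suc (suc m)) {zero}        {suc (suc q)} s = det-swap-conj (det-swap (suc m)) s
det-swap (suc (suc m)) {suc (suc q)} {zero}        s =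
  det-swap-conj (det-swap (suc m)) (RowsSwapped-sym s)

x≡-x⇒x≡0 : ∀ {x} → x ≡ - x → x ≡ 0ℚ
x≡-x⇒x≡0 {x} x≡-x = begin
  x               ≡⟨ solve 1 (λ x → x := (x :+ x) :* con ½) refl x ⟩
  (x + x) * ½     ≡⟨ cong (λ y → (x + y) * ½) x≡-x ⟩
  (x + - x) * ½   ≡⟨ cong (_* ½) (+-inverseʳ x) ⟩
  0ℚ * ½          ≡⟨⟩
  0ℚ              ∎
  where open ≡-Reasoning

det-equalRows : ∀ n {A : Matrix n} {p q} → p ≢ q → A p ≗ A q → det n A ≡ 0ℚ
det-equalRows n p≢q Ap≗Aq = x≡-x⇒x≡0 (det-swap n (record
  { distinct  = p≢q
  ; swapped-p = Ap≗Aq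
  ; swapped-q = sym ∘ Ap≗Aq
  ; unchanged = λ _ _ _ _ → refl
  }))

det-proportionalRows : ∀ n {A : Matrix n} {p q} c → p ≢ q → (∀ j → A q j ≡ c * A p j) →
  det n A ≡ 0ℚ
det-proportionalRows n {A} {p} {q} c p≢q Aq≡cAp = begin
  det n A      ≡⟨ det-scaleRow n {B} {A} c (λ j → trans (Aq≡cAp j) (cong (c *_) (sym (Bq≗Ap j))))
                    (λ r r≢q → sym ∘ cong-app (updateAt-minimal r q A r≢q)) ⟩
  c * det n B  ≡⟨ cong (c *_) (det-equalRows n p≢q (λ j → trans (Bp≗Ap j) (sym (Bq≗Ap j)))) ⟩
  c * 0ℚ       ≡⟨ *-zeroʳ c ⟩
  0ℚ           ∎
  where
  open ≡-Reasoning
  B : Matrix n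
  B = updateAt A q (const (A p))
  Bq≗Ap : B q ≗ A p
  Bq≗Ap = cong-app (updateAt-updates q A)
  Bp≗Ap : B p ≗ A p
  Bp≗Ap = cong-app (updateAt-minimal p q A p≢q)

shift : ∀ {k} → (Fin k → ℕ) → Fin k → ℕ
shift a i = toℕ i ℕ.+ a i

shift-injective⇒zero : ∀ {k} (a : Fin k → ℕ) → Injective _≡_ _≡_ (shift a) →
  ∀ i → toℕ i ℕ.+ ∣ a ∣ ℕ.< k → a i ≡ 0
shift-injective⇒zero {suc k} a inj (suc i) i+∣a∣<k =
  shift-injective⇒zero (a ∘ suc) (suc-injective ∘ inj ∘ cong suc) i
    (ℕ.≤-<-trans (ℕ.+-monoʳ-≤ (toℕ i) (ℕ.m≤n+m _ (a zero))) (ℕ.s<s⁻¹ i+∣a∣<k))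
shift-injective⇒zero {suc k} a inj zero ∣a∣<k with a zero in a₀≡
... | zero  = refl
... | suc u = contradiction (inj collision) λ ()
  where
  u+∣a′∣<k : u ℕ.+ ∣ a ∘ suc ∣ ℕ.< k
  u+∣a′∣<k = ℕ.s<s⁻¹ ∣a∣<k
  u<k : u ℕ.< k
  u<k = ℕ.≤-<-trans (ℕ.m≤m+n u _) u+∣a′∣<k
  j : Fin k
  j = fromℕ< u<k
  a′j≡0 : a (suc j) ≡ 0
  a′j≡0 = shift-injective⇒zero (a ∘ suc) (suc-injective ∘ inj ∘ cong suc) j
    (subst (λ t → t ℕ.+ ∣ a ∘ suc ∣ ℕ.< k) (sym (toℕ-fromℕ< u<k)) u+∣a′∣<k)
  collision : shift a zero ≡ shift a (suc j)
  collision = trans a₀≡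
    (cong suc (sym (trans (cong₂ ℕ._+_ (toℕ-fromℕ< u<k) a′j≡0) (ℕ.+-identityʳ u))))

shift-injective⇒LeadingZeros : ∀ {k} (a : Fin k → ℕ) → Injective _≡_ _≡_ (shift a) →
  LeadingZeros a
shift-injective⇒LeadingZeros a inj i i<k∸∣a∣ = shift-injective⇒zero a inj i
  (ℕ.m≤o∸n⇒m+n≤o (suc (toℕ i)) (ℕ.<⇒≤ (ℕ.m∸n≢0⇒n<m (ℕ.m<n⇒n≢0 i<k∸∣a∣))) i<k∸∣a∣)

gammaArg-reassoc : ∀ x m j n → x ℤ.- ℤ.+ m ℤ.- ℤ.+ j ℤ.- ℤ.+ n ≡ x ℤ.- ℤ.+ (m ℕ.+ n) ℤ.- ℤ.+ j
gammaArg-reassoc x m j n rewrite pos-+ m n =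
  Z.solve 4 (λ x m j n → x Z.:- m Z.:- j Z.:- n Z.:= x Z.:- (m Z.:+ n) Z.:- j) refl
    x (ℤ.+ m) (ℤ.+ j) (ℤ.+ n)
  where module Z = ℤ-Solver.+-*-Solver

upperRow : (k s : ℕ) → Fin (k ℕ.+ k) → ℚ
upperRow k s j = recipGamma (ℤ.+ (2 ℕ.* k) ℤ.- ℤ.+ s ℤ.- ℤ.+ toℕ j)

lowerRow : (k s : ℕ) → Fin (k ℕ.+ k) → ℚ
lowerRow k s j = signℚ (suc (toℕ j)) * upperRow k s j

Mmat-↑ˡ : ∀ k a b i j → Mmat k a b (i ↑ˡ k) j ≡ upperRow k (shift a i) j
Mmat-↑ˡ k a b i j rewrite splitAt-↑ˡ k i k =
  cong recipGamma (gammaArg-reassoc (ℤ.+ (2 ℕ.* k)) (toℕ i) (toℕ j) (a i))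

Mmat-↑ʳ : ∀ k a b i j → Mmat k a b (k ↑ʳ i) j ≡ signℚ (toℕ i) * lowerRow k (shift b i) j
Mmat-↑ʳ k a b i j rewrite splitAt-↑ʳ k k i =
  trans (cong₂ _*_ (trans (cong signℚ (sym (ℕ.+-suc (toℕ i) (toℕ j)))) (signℚ-+ (toℕ i) _))
                   (cong recipGamma (gammaArg-reassoc (ℤ.+ (2 ℕ.* k)) (toℕ i) (toℕ j) (b i))))
        (*-assoc (signℚ (toℕ i)) _ _)

module _ (k : ℕ) (a b : Fin k → ℕ) where

  det-Mmat-upper-collision : ∀ {i i′} → i ≢ i′ → shift a i ≡ shift a i′ →
    det (k ℕ.+ k) (Mmat k a b) ≡ 0ℚ
  det-Mmat-upper-collision {i} {i′} i≢i′ shifts≡ =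
    det-equalRows (k ℕ.+ k) (i≢i′ ∘ ↑ˡ-injective k i i′) λ j →
      trans (Mmat-↑ˡ k a b i j)
        (trans (cong (λ s → upperRow k s j) shifts≡) (sym (Mmat-↑ˡ k a b i′ j)))

  det-Mmat-lower-collision : ∀ {i i′} → i ≢ i′ → shift b i ≡ shift b i′ →
    det (k ℕ.+ k) (Mmat k a b) ≡ 0ℚ
  det-Mmat-lower-collision {i} {i′} i≢i′ shifts≡ =
    det-proportionalRows (k ℕ.+ k) (signℚ (toℕ i′) * signℚ (toℕ i))
      (i≢i′ ∘ ↑ʳ-injective k i i′) λ j → begin
        Mmat k a b (k ↑ʳ i′) j
          ≡⟨ Mmat-↑ʳ k a b i′ j ⟩
        signℚ (toℕ i′) * lowerRow k (shift b i′) j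
          ≡⟨ cong (λ s → signℚ (toℕ i′) * lowerRow k s j) (sym shifts≡) ⟩
        signℚ (toℕ i′) * lowerRow k (shift b i) j
          ≡⟨ sym (signℚ-square-cancel (toℕ i) (toℕ i′) (lowerRow k (shift b i) j)) ⟩
        signℚ (toℕ i′) * signℚ (toℕ i) * (signℚ (toℕ i) * lowerRow k (shift b i) j)
          ≡⟨ cong (signℚ (toℕ i′) * signℚ (toℕ i) *_) (sym (Mmat-↑ʳ k a b i j)) ⟩
        signℚ (toℕ i′) * signℚ (toℕ i) * Mmat k a b (k ↑ʳ i) j ∎
    where open ≡-Reasoning

lemma5 : (k : ℕ) → k ≥ 1 → (a b : Fin k → ℕ) →
    ¬ (LeadingZeros a × LeadingZeros b) → Mtilde k a b ≡ 0ℚ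
lemma5 k _ a b ¬leadingZeros with det (k ℕ.+ k) (Mmat k a b) ≟ℚ 0ℚ
... | yes det≡0 = trans (cong (signℚ ∣ b ∣ *_) det≡0) (*-zeroʳ (signℚ ∣ b ∣))
... | no det≢0  = contradiction
  ( shift-injective⇒LeadingZeros a (injective (det-Mmat-upper-collision k a b))
  , shift-injective⇒LeadingZeros b (injective (det-Mmat-lower-collision k a b)))
  ¬leadingZeros
  where
  injective : ∀ {f : Fin k → ℕ} →
    (∀ {i i′} → i ≢ i′ → f i ≡ f i′ → det (k ℕ.+ k) (Mmat k a b) ≡ 0ℚ) → Injective _≡_ _≡_ f
  injective collision {i} {i′} fi≡fi′ =
    decidable-stable (i ≟ i′) (λ i≢i′ → det≢0 (collision i≢i′ fi≡fi′))
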